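{- Let $k\ge1$ and for $1\le j\le k$ let $\mathcal{U}^k_j(x)=\sum_{n\ge 1} U^k_j(n)\frac{x^n}{n!}$ (formal power series with zero constant term), and set $\mathcal{U}^k_0(x)=0$. Then for each $j=1,2,\dots,k$, $$\frac{d}{dx}\mathcal{U}_j^k(x) = 1 + \mathcal{U}_j^k(x) + \mathcal{U}_{j-1}^k(x) + \mathcal{U}_{k-1}^k(x)\,\mathcal{U}_{j}^k(x).$$
   Context: For a permutation $p=(p_1,\dots,p_n)$ of $\{1,\dots,n\}$, an increasing run is a maximal increasing subsequence of consecutive entries $p_a<p_{a+1}<\dots<p_b$; its length is $b-a+1$. The final increasing run is the increasing run containing $p_n$. For integers $k\ge1$, $1\le j\le k$ and $n\ge 1$, $U^k_j(n)$ denotes the number of permutations of $\{1,\dots,n\}$ all of whose increasing runs have length at most $k$ and whose final increasing run has length at most $j$; by convention $U^k_j(n)=0$ whenever $j<1$. -}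

module Defs where

open import Data.Nat using (ℕ; zero; suc; _+_; _*_; _∸_; _≤_; _<_; _≤?_; _<ᵇ_)
open import Data.Nat.Properties using (_≟_; _!≢0)
open import Data.Nat.Combinatorics using (_C_)
open import Data.Nat using (_!)
open import Data.Bool using (if_then_else_)
open import Data.List using (List; []; _∷_; length; filter; concatMap; map; upTo)
open import Data.List.Relation.Unary.All using (All; all?)
open import Data.List.Relation.Unary.Unique.DecPropositional _≟_ using (Unique; unique?)
open import Data.Product using (_×_)
open import Relation.Nullary using (Dec)
open import Relation.Nullary.Decidable using (_×-dec_)
open import Relation.Unary using (Decidable)
open import Data.Integer using (+_)
open import Data.Rational as ℚ using (ℚ)

words : List ℕ → ℕ → List (List ℕ)
words xs zero    = [] ∷ []
words xs (suc n) = concatMap (λ x → map (x ∷_) (words xs n)) xs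

oneTo : ℕ → List ℕ
oneTo n = map suc (upTo n)

-- permutations of {1,...,n} (in one-line notation):
-- words of length n over {1,...,n} with no repeated entry
IsPerm : List ℕ → Set
IsPerm p = Unique p

permutations : ℕ → List (List ℕ)
permutations n = filter unique? (words (oneTo n) n)

runsFrom : ℕ → ℕ → List ℕ → List ℕ
runsFrom prev len []       = len ∷ []
runsFrom prev len (y ∷ ys) =
  if prev <ᵇ y then runsFrom y (suc len) ys else len ∷ runsFrom y 1 ys

runLengths : List ℕ → List ℕ
runLengths []       = []
runLengths (x ∷ xs) = runsFrom x 1 xs

-- length of the final increasing run (0 for the empty word)
finalRunLength : List ℕ → ℕ
finalRunLength []       = 0
finalRunLength (x ∷ []) = x
finalRunLength (x ∷ y ∷ ys) = finalRunLength (y ∷ ys)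

lastRun : List ℕ → ℕ
lastRun p = finalRunLength (runLengths p)

Good : ℕ → ℕ → List ℕ → Set
Good k j p = All (λ r → r ≤ k) (runLengths p) × lastRun p ≤ j

good? : (k j : ℕ) → Decidable (Good k j)
good? k j p = all? (λ r → r ≤? k) (runLengths p) ×-dec (lastRun p ≤? j)

U : ℕ → ℕ → ℕ → ℕ
U k zero    n = 0
U k (suc j) n = length (filter (good? k (suc j)) (permutations n))

FPS : Set
FPS = ℕ → ℚ

infixl 6 _⊕_
infixl 7 _⊛_

_⊕_ : FPS → FPS → FPS
(f ⊕ g) n = f n ℚ.+ g n

sumTo : ℕ → (ℕ → ℚ) → ℚ
sumTo zero    f = f 0
sumTo (suc n) f = sumTo n f ℚ.+ f (suc n)

_⊛_ : FPS → FPS → FPS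
(f ⊛ g) n = sumTo n (λ i → f i ℚ.* g (n ∸ i))

deriv : FPS → FPS
deriv f n = (+ suc n ℚ./ 1) ℚ.* f (suc n)

oneS : FPS
oneS zero    = ℚ.1ℚ
oneS (suc n) = ℚ.0ℚ

𝒰 : ℕ → ℕ → FPS
𝒰 k j zero    = ℚ.0ℚ
𝒰 k j (suc n) = (+ U k j (suc n) ℚ./ (suc n !)) {{suc n !≢0}}

module Submission where

-- On the coefficient of xⁿ/n! (n ≥ 1) this is the recurrence
--   U_j(n+1) = U_j(n) + U_{j-1}(n) + Σ_i C(n,i) U_{k-1}(i) U_j(n-i),
-- obtained by cutting a permutation of {1,…,n+1} at its largest entry,
-- w = a ++ (n+1) ∷ b.  The entry n+1 ends the final run of a, so w is good
-- iff either b is empty and a is good for (k, j-1), or b is nonempty, a is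
-- good for (k, k-1) and b is good for (k, j).  The entries of a form any
-- i-subset of {1,…,n}, and only their relative order matters.

open import Defs
open import Data.Nat using (ℕ; zero; suc; _+_; _*_; _∸_; _≤_; _<_; z≤n; s≤s; _<ᵇ_; NonZero; _!)
open import Data.Nat.Properties
open import Data.Nat.Combinatorics using (_C_; nCn≡1; nCk+nC[k+1]≡[n+1]C[k+1]; nCk≡n!/k![n-k]!; k![n∸k]!∣n!)
open import Data.Nat.DivMod using (m/n*n≡m)
open import Data.Nat.Tactic.RingSolver using (solve-∀)
import Data.Integer as ℤ
import Data.Integer.Properties as ℤ
open import Data.Rational as ℚ using (ℚ; _/_; toℚᵘ)
import Data.Rational.Properties as ℚ
open import Data.Rational.Unnormalised as ℚᵘ using (mkℚᵘ; *≡*)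
import Data.Rational.Unnormalised.Properties as ℚᵘ
open import Data.List using (List; []; _∷_; _++_; [_]; length; filter; map; concatMap; upTo; applyUpTo)
open import Data.List.Properties
  using ( ++-identityʳ; ++-cancelˡ; map-++; map-∘; map-upTo; upTo-∷ʳ; length-++; length-map; length-upTo
        ; concatMap-map; map-concatMap; concatMap-cong; ∷-injective; ∷-injectiveˡ; ∷-injectiveʳ)
open import Data.List.Membership.Propositional using (_∈_; _∉_; find; lose)
open import Data.List.Membership.Propositional.Properties
open import Data.List.Relation.Binary.Subset.Propositional using (_⊆_)
open import Data.List.Relation.Unary.Any using (here; there)
open import Data.List.Relation.Unary.All as All using (All; []; _∷_)
open import Data.List.Relation.Unary.AllPairs as AllPairs using (AllPairs; []; _∷_)
import Data.List.Relation.Unary.All.Properties as All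
import Data.List.Relation.Unary.AllPairs.Properties as AllPairs
open import Data.List.Relation.Unary.Unique.Propositional using (Unique)
import Data.List.Relation.Unary.Unique.Propositional.Properties as Unique
open import Data.List.Relation.Unary.Unique.DecPropositional _≟_ using (unique?)
open import Data.Product using (∃; ∃₂; _×_; _,_; proj₁; proj₂)
open import Data.Sum using (inj₁; inj₂)
open import Data.Empty using (⊥; ⊥-elim)
open import Data.Unit using (⊤)
open import Data.Bool using (true; false)
open import Data.Bool.Properties using (T-≡)
open import Relation.Nullary using (¬_; yes; no)
open import Relation.Nullary.Decidable using (¬?)
open import Relation.Unary using (Decidable)
open import Relation.Unary.Properties using (_∩?_; U?)
open import Relation.Binary.PropositionalEquality hiding ([_])
open import Relation.Binary.Definitions using (DecidableEquality; tri<; tri≈; tri>)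
open import Function using (_∘_; id)
open import Function.Bundles using (_⇔_; mk⇔; Equivalence)
open Equivalence using (to; from)

private
  variable
    A B D : Set

unique-⊆-length : {xs ys : List A} → Unique xs → xs ⊆ ys → length xs ≤ length ys
unique-⊆-length {xs = []} _ _ = z≤n
unique-⊆-length {xs = x ∷ xs} (x∉xs ∷ u) xs⊆ys
  with ys₁ , ys₂ , refl ← ∈-∃++ (xs⊆ys (here refl)) =
  subst (suc (length xs) ≤_) (sym length-remove) (s≤s (unique-⊆-length u xs⊆rest))
  where
  length-remove : length (ys₁ ++ x ∷ ys₂) ≡ suc (length (ys₁ ++ ys₂))
  length-remove = begin
    length (ys₁ ++ x ∷ ys₂)             ≡⟨ length-++ ys₁ ⟩
    length ys₁ + suc (length ys₂)       ≡⟨ +-suc (length ys₁) (length ys₂) ⟩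
    suc (length ys₁ + length ys₂)       ≡⟨ cong suc (sym (length-++ ys₁)) ⟩
    suc (length (ys₁ ++ ys₂))           ∎
    where open ≡-Reasoning
  -- x itself does not occur in xs, so xs avoids the removed copy of x
  xs⊆rest : xs ⊆ ys₁ ++ ys₂
  xs⊆rest {y} y∈xs with ∈-++⁻ ys₁ (xs⊆ys (there y∈xs))
  ... | inj₁ y∈ys₁         = ∈-++⁺ˡ y∈ys₁
  ... | inj₂ (here refl)   = ⊥-elim (All.lookup x∉xs y∈xs refl)
  ... | inj₂ (there y∈ys₂) = ∈-++⁺ʳ ys₁ y∈ys₂

-- Two duplicate-free lists with the same members have the same length;
-- this is how every bijective count below is carried out.
unique-≋-length : {xs ys : List A} → Unique xs → Unique ys → xs ⊆ ys → ys ⊆ xs →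
                  length xs ≡ length ys
unique-≋-length u v xs⊆ys ys⊆xs = ≤-antisym (unique-⊆-length u xs⊆ys) (unique-⊆-length v ys⊆xs)

unique-⊆-full : DecidableEquality A → {xs ys : List A} → Unique xs → xs ⊆ ys →
                length ys ≤ length xs → ys ⊆ xs
unique-⊆-full _≟ᴬ_ {xs} {ys} u xs⊆ys ys≤xs {y} y∈ys with _∈?_ y xs
  where open import Data.List.Membership.DecPropositional _≟ᴬ_ using (_∈?_)
... | yes y∈xs = y∈xs
... | no  y∉xs = ⊥-elim (<⇒≱ (unique-⊆-length (y∉xs′ ∷ u) y∷xs⊆ys) ys≤xs)
  where
  y∉xs′ : All (y ≢_) xs
  y∉xs′ = All.tabulate (λ { z∈xs refl → y∉xs z∈xs })
  y∷xs⊆ys : y ∷ xs ⊆ ys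
  y∷xs⊆ys (here refl)  = y∈ys
  y∷xs⊆ys (there z∈xs) = xs⊆ys z∈xs

∈-concatMap-intro : (f : A → List B) {xs : List A} {a : A} {w : B} →
                    a ∈ xs → w ∈ f a → w ∈ concatMap f xs
∈-concatMap-intro f a∈xs w∈fa = ∈-concatMap⁺ f (lose a∈xs w∈fa)

∈-concatMap-elim : (f : A → List B) (xs : List A) {w : B} →
                   w ∈ concatMap f xs → ∃ λ a → a ∈ xs × w ∈ f a
∈-concatMap-elim f xs w∈ = find (∈-concatMap⁻ f {xs} w∈)

unique-concatMap : (f : A → List B) (xs : List A) → Unique xs →
  (∀ {a} → a ∈ xs → Unique (f a)) →
  (∀ {a b w} → a ∈ xs → b ∈ xs → w ∈ f a → w ∈ f b → a ≡ b) →
  Unique (concatMap f xs)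
unique-concatMap f [] _ _ _ = []
unique-concatMap f (x ∷ xs) (x∉xs ∷ u) uf disjoint =
  Unique.++⁺ (uf (here refl)) (unique-concatMap f xs u (uf ∘ there) (λ a b → disjoint (there a) (there b)))
    λ (w∈fx , w∈rest) → let (b , b∈xs , w∈fb) = ∈-concatMap-elim f xs w∈rest in
      All.lookup x∉xs b∈xs (disjoint (here refl) (there b∈xs) w∈fx w∈fb)

unique-++⁻ : (xs : List A) {ys : List A} → Unique (xs ++ ys) → Unique xs × Unique ys × (∀ {y} → y ∈ xs → y ∉ ys)
unique-++⁻ []       u = [] , u , λ ()
unique-++⁻ (x ∷ xs) (x∉ ∷ u) =
  let (u-xs , u-ys , disjoint) = unique-++⁻ xs u in
  All.tabulate (All.lookup x∉ ∘ ∈-++⁺ˡ) ∷ u-xs , u-ys ,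
  λ { (here refl) y∈ys → All.lookup x∉ (∈-++⁺ʳ xs y∈ys) refl ; (there y∈xs) → disjoint y∈xs }

++-∷-cancel : {m : A} (a b a′ b′ : List A) → a ++ m ∷ b ≡ a′ ++ m ∷ b′ → m ∉ a → m ∉ a′ → a ≡ a′ × b ≡ b′
++-∷-cancel []      b []       b′ eq _    _     = refl , ∷-injectiveʳ eq
++-∷-cancel []      b (x ∷ a′) b′ eq _    m∉a′  = ⊥-elim (m∉a′ (here (∷-injectiveˡ eq)))
++-∷-cancel (x ∷ a) b []       b′ eq m∉a  _     = ⊥-elim (m∉a (here (sym (∷-injectiveˡ eq))))
++-∷-cancel (x ∷ a) b (x′ ∷ a′) b′ eq m∉a m∉a′ with refl , eq′ ← ∷-injective eq =
  let (a≡ , b≡) = ++-∷-cancel a b a′ b′ eq′ (m∉a ∘ there) (m∉a′ ∘ there) in cong (x ∷_) a≡ , b≡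

sumOver : (A → ℕ) → List A → ℕ
sumOver f []       = 0
sumOver f (x ∷ xs) = f x + sumOver f xs

sumOver-++ : (f : A → ℕ) (xs ys : List A) → sumOver f (xs ++ ys) ≡ sumOver f xs + sumOver f ys
sumOver-++ f []       ys = refl
sumOver-++ f (x ∷ xs) ys = trans (cong (f x +_) (sumOver-++ f xs ys)) (sym (+-assoc (f x) _ _))

sumOver-cong : (f g : A → ℕ) (xs : List A) → (∀ {x} → x ∈ xs → f x ≡ g x) → sumOver f xs ≡ sumOver g xs
sumOver-cong f g []       _   = refl
sumOver-cong f g (x ∷ xs) f≗g = cong₂ _+_ (f≗g (here refl)) (sumOver-cong f g xs (f≗g ∘ there))

sumOver-const : (c : ℕ) (xs : List A) → sumOver (λ _ → c) xs ≡ length xs * c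
sumOver-const c []       = refl
sumOver-const c (x ∷ xs) = cong (c +_) (sumOver-const c xs)

sumOver-concatMap : (g : B → ℕ) (f : A → List B) (xs : List A) →
                    sumOver g (concatMap f xs) ≡ sumOver (sumOver g ∘ f) xs
sumOver-concatMap g f []       = refl
sumOver-concatMap g f (x ∷ xs) =
  trans (sumOver-++ g (f x) (concatMap f xs)) (cong (sumOver g (f x) +_) (sumOver-concatMap g f xs))

length-concatMap : (f : A → List B) (xs : List A) → length (concatMap f xs) ≡ sumOver (length ∘ f) xs
length-concatMap f []       = refl
length-concatMap f (x ∷ xs) = trans (length-++ (f x)) (cong (length (f x) +_) (length-concatMap f xs))

count : {P : A → Set} → Decidable P → List A → ℕ
count P? xs = length (filter P? xs)

count-cong : {P Q : A → Set} (P? : Decidable P) (Q? : Decidable Q) (xs : List A) →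
             (∀ {x} → x ∈ xs → P x ⇔ Q x) → count P? xs ≡ count Q? xs
count-cong P? Q? []       _ = refl
count-cong P? Q? (x ∷ xs) P⇔Q with P? x | Q? x
... | yes _  | yes _  = cong suc (count-cong P? Q? xs (P⇔Q ∘ there))
... | no  _  | no  _  = count-cong P? Q? xs (P⇔Q ∘ there)
... | yes px | no ¬qx = ⊥-elim (¬qx (to (P⇔Q (here refl)) px))
... | no ¬px | yes qx = ⊥-elim (¬px (from (P⇔Q (here refl)) qx))

count-none : {P : A → Set} (P? : Decidable P) (xs : List A) → (∀ {x} → x ∈ xs → ¬ P x) → count P? xs ≡ 0
count-none P? []       _  = refl
count-none P? (x ∷ xs) ¬P with P? x
... | yes px = ⊥-elim (¬P (here refl) px)
... | no  _  = count-none P? xs (¬P ∘ there)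

count-++ : {P : A → Set} (P? : Decidable P) (xs ys : List A) → count P? (xs ++ ys) ≡ count P? xs + count P? ys
count-++ P? []       ys = refl
count-++ P? (x ∷ xs) ys with P? x
... | yes _ = cong suc (count-++ P? xs ys)
... | no  _ = count-++ P? xs ys

count-map : {P : B → Set} (P? : Decidable P) (f : A → B) (xs : List A) → count P? (map f xs) ≡ count (P? ∘ f) xs
count-map P? f []       = refl
count-map P? f (x ∷ xs) with P? (f x)
... | yes _ = cong suc (count-map P? f xs)
... | no  _ = count-map P? f xs

count-filter : {P Q : A → Set} (P? : Decidable P) (Q? : Decidable Q) (xs : List A) →
               count Q? (filter P? xs) ≡ count (P? ∩? Q?) xs
count-filter P? Q? []       = refl
count-filter P? Q? (x ∷ xs) with P? x
... | no  _ = count-filter P? Q? xs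
... | yes _ with Q? x
...   | yes _ = cong suc (count-filter P? Q? xs)
...   | no  _ = count-filter P? Q? xs

count-product : {P : D → Set} {Q : A → Set} {R : B → Set}
  (P? : Decidable P) (Q? : Decidable Q) (R? : Decidable R) (g : A → B → D) (as : List A) (bs : List B) →
  (∀ {a b} → a ∈ as → b ∈ bs → P (g a b) ⇔ (Q a × R b)) →
  count P? (concatMap (λ a → map (g a) bs) as) ≡ count Q? as * count R? bs
count-product P? Q? R? g []       bs _ = refl
count-product P? Q? R? g (a ∷ as) bs P⇔QR =
  trans (count-++ P? (map (g a) bs) _)
        (trans (cong₂ _+_ (count-map P? (g a) bs) (count-product P? Q? R? g as bs (P⇔QR ∘ there)))
               first-row)
  where
  first-row : count (P? ∘ g a) bs + count Q? as * count R? bs ≡ count Q? (a ∷ as) * count R? bs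
  first-row with Q? a
  ... | yes qa = cong (_+ _) (count-cong (P? ∘ g a) R? bs
                   λ b∈ → mk⇔ (proj₂ ∘ to (P⇔QR (here refl) b∈)) (λ rb → from (P⇔QR (here refl) b∈) (qa , rb)))
  ... | no ¬qa = cong (_+ _) (count-none (P? ∘ g a) bs λ b∈ → ¬qa ∘ proj₁ ∘ to (P⇔QR (here refl) b∈))

∈-words⁺ : (xs : List ℕ) (n : ℕ) {w : List ℕ} → length w ≡ n → All (_∈ xs) w → w ∈ words xs n
∈-words⁺ xs zero    {[]}    refl []            = here refl
∈-words⁺ xs (suc n) {y ∷ w} eq   (y∈xs ∷ w⊆xs) =
  ∈-concatMap-intro (λ x → map (x ∷_) (words xs n)) y∈xs
    (∈-map⁺ (y ∷_) (∈-words⁺ xs n (suc-injective eq) w⊆xs))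

∈-words⁻ : (xs : List ℕ) (n : ℕ) {w : List ℕ} → w ∈ words xs n → length w ≡ n × All (_∈ xs) w
∈-words⁻ xs zero    (here refl) = refl , []
∈-words⁻ xs (suc n) w∈
  with x , x∈xs , w∈x∷ ← ∈-concatMap-elim (λ x → map (x ∷_) (words xs n)) xs w∈
  with v , v∈ , refl   ← ∈-map⁻ (x ∷_) w∈x∷
  = let (len , v⊆xs) = ∈-words⁻ xs n v∈ in cong suc len , x∈xs ∷ v⊆xs

words-unique : (xs : List ℕ) (n : ℕ) → Unique xs → Unique (words xs n)
words-unique xs zero    _ = [] ∷ []
words-unique xs (suc n) u = unique-concatMap (λ x → map (x ∷_) (words xs n)) xs u
  (λ _ → Unique.map⁺ ∷-injectiveʳ (words-unique xs n u))
  (λ _ _ w∈xW w∈yW → let (_ , _ , w≡) = ∈-map⁻ _ w∈xW ; (_ , _ , w≡′) = ∈-map⁻ _ w∈yW in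
     proj₁ (∷-injective (trans (sym w≡) w≡′)))

arrangements : List ℕ → List (List ℕ)
arrangements xs = filter unique? (words xs (length xs))

record IsArrangement (xs w : List ℕ) : Set where
  field
    distinct   : Unique w
    within     : w ⊆ xs
    sameLength : length w ≡ length xs

∈-arrangements⁺ : {xs w : List ℕ} → IsArrangement xs w → w ∈ arrangements xs
∈-arrangements⁺ {xs} {w} arr = ∈-filter⁺ unique? (∈-words⁺ xs (length xs) sameLength (All.tabulate within)) distinct
  where open IsArrangement arr

∈-arrangements⁻ : {xs w : List ℕ} → w ∈ arrangements xs → IsArrangement xs w
∈-arrangements⁻ {xs} {w} w∈ =
  let (w∈words , u) = ∈-filter⁻ unique? w∈ ; (len , w⊆xs) = ∈-words⁻ xs (length xs) w∈words in
  record { distinct = u ; within = All.lookup w⊆xs ; sameLength = len }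

arrangements-unique : (xs : List ℕ) → Unique xs → Unique (arrangements xs)
arrangements-unique xs u = Unique.filter⁺ unique? (words-unique xs (length xs) u)

arrangement-covers : {xs w : List ℕ} → IsArrangement xs w → xs ⊆ w
arrangement-covers arr = unique-⊆-full _≟_ distinct within (≤-reflexive (sym sameLength))
  where open IsArrangement arr

length-oneTo : (n : ℕ) → length (oneTo n) ≡ n
length-oneTo n = trans (length-map suc (upTo n)) (length-upTo n)

permutations≡arrangements : (n : ℕ) → permutations n ≡ arrangements (oneTo n)
permutations≡arrangements n = cong (λ l → filter unique? (words (oneTo n) l)) (sym (length-oneTo n))

∈-oneTo⁻ : {n x : ℕ} → x ∈ oneTo n → 1 ≤ x × x ≤ n
∈-oneTo⁻ x∈ with i , i∈ , refl ← ∈-map⁻ suc x∈ = s≤s z≤n , ∈-upTo⁻ i∈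

oneTo-sorted : (n : ℕ) → AllPairs _<_ (oneTo n)
oneTo-sorted n = subst (AllPairs _<_) (sym (map-upTo suc n)) (AllPairs.applyUpTo⁺₁ suc n (λ i<j _ → s≤s i<j))

sorted⇒unique : {xs : List ℕ} → AllPairs _<_ xs → Unique xs
sorted⇒unique = AllPairs.map <⇒≢

<ᵇ-true : {p m : ℕ} → p < m → (p <ᵇ m) ≡ true
<ᵇ-true p<m = to T-≡ (<⇒<ᵇ p<m)

<ᵇ-false : {p m : ℕ} → m ≤ p → (p <ᵇ m) ≡ false
<ᵇ-false {p} {m} m≤p with p <ᵇ m in eq
... | true  = ⊥-elim (<⇒≱ (<ᵇ⇒< p m (from T-≡ eq)) m≤p)
... | false = refl

-- The run lengths of w ++ [m] for m above all of w: the final run grows by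
-- one, or a run of length 1 appears when w is empty.
extendLast : List ℕ → List ℕ
extendLast []           = 1 ∷ []
extendLast (r ∷ [])     = suc r ∷ []
extendLast (r ∷ s ∷ rs) = r ∷ extendLast (s ∷ rs)

extendLast-nonempty : (rs : List ℕ) → extendLast rs ≢ []
extendLast-nonempty []           ()
extendLast-nonempty (r ∷ [])     ()
extendLast-nonempty (r ∷ s ∷ rs) ()

extendLast-∷ : (r : ℕ) (rs : List ℕ) → rs ≢ [] → extendLast (r ∷ rs) ≡ r ∷ extendLast rs
extendLast-∷ r []      rs≢[] = ⊥-elim (rs≢[] refl)
extendLast-∷ r (_ ∷ _) _     = refl

runsFrom-nonempty : (p l : ℕ) (xs : List ℕ) → runsFrom p l xs ≢ []
runsFrom-nonempty p l []       ()
runsFrom-nonempty p l (y ∷ ys) with p <ᵇ y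
... | true  = runsFrom-nonempty y (suc l) ys
... | false = λ ()

runsFrom-insert-max : (p l : ℕ) (xs : List ℕ) {m : ℕ} {b : List ℕ} → p < m → All (_< m) xs → All (_< m) b →
  runsFrom p l (xs ++ m ∷ b) ≡ extendLast (runsFrom p l xs) ++ runLengths b
runsFrom-insert-max p l [] {b = []} p<m _ _ rewrite <ᵇ-true p<m = refl
runsFrom-insert-max p l [] {m} {y ∷ b} p<m _ (y<m ∷ _)
  rewrite <ᵇ-true p<m | <ᵇ-false {m} {y} (<⇒≤ y<m) = refl
runsFrom-insert-max p l (x ∷ xs) p<m (x<m ∷ xs<m) b<m with p <ᵇ x
... | true  = runsFrom-insert-max x (suc l) xs x<m xs<m b<m
... | false = trans (cong (l ∷_) (runsFrom-insert-max x 1 xs x<m xs<m b<m))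
                    (cong (_++ _) (sym (extendLast-∷ l _ (runsFrom-nonempty x 1 xs))))

runLengths-insert-max : {m : ℕ} (a b : List ℕ) → All (_< m) a → All (_< m) b →
  runLengths (a ++ m ∷ b) ≡ extendLast (runLengths a) ++ runLengths b
runLengths-insert-max []      []      _ _ = refl
runLengths-insert-max {m} [] (y ∷ b) _ (y<m ∷ _) rewrite <ᵇ-false {m} {y} (<⇒≤ y<m) = refl
runLengths-insert-max (x ∷ a) b (x<m ∷ a<m) b<m = runsFrom-insert-max x 1 a x<m a<m b<m

finalRunLength-++ : (rs ss : List ℕ) → ss ≢ [] → finalRunLength (rs ++ ss) ≡ finalRunLength ss
finalRunLength-++ []           ss ss≢[] = refl
finalRunLength-++ (r ∷ [])     []      ss≢[] = ⊥-elim (ss≢[] refl)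
finalRunLength-++ (r ∷ [])     (_ ∷ _) _     = refl
finalRunLength-++ (r ∷ s ∷ rs) ss ss≢[] = finalRunLength-++ (s ∷ rs) ss ss≢[]

finalRunLength-extendLast : (rs : List ℕ) → finalRunLength (extendLast rs) ≡ suc (finalRunLength rs)
finalRunLength-extendLast []           = refl
finalRunLength-extendLast (r ∷ [])     = refl
finalRunLength-extendLast (r ∷ s ∷ rs) =
  trans (finalRunLength-++ [ r ] (extendLast (s ∷ rs)) (extendLast-nonempty (s ∷ rs)))
        (finalRunLength-extendLast (s ∷ rs))

all-extendLast⁻ : {k : ℕ} (rs : List ℕ) → All (_≤ k) (extendLast rs) → All (_≤ k) rs × suc (finalRunLength rs) ≤ k
all-extendLast⁻ []           (1≤k ∷ [])  = [] , 1≤k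
all-extendLast⁻ (r ∷ [])     (r<k ∷ [])  = (<⇒≤ r<k ∷ []) , r<k
all-extendLast⁻ (r ∷ s ∷ rs) (r≤k ∷ ext) = let (rest , room) = all-extendLast⁻ (s ∷ rs) ext in (r≤k ∷ rest) , room

all-extendLast⁺ : {k : ℕ} (rs : List ℕ) → All (_≤ k) rs → suc (finalRunLength rs) ≤ k → All (_≤ k) (extendLast rs)
all-extendLast⁺ []           _            1≤k  = 1≤k ∷ []
all-extendLast⁺ (r ∷ [])     _            r<k  = r<k ∷ []
all-extendLast⁺ (r ∷ s ∷ rs) (r≤k ∷ rest) room = r≤k ∷ all-extendLast⁺ (s ∷ rs) rest room

GoodRuns : ℕ → ℕ → List ℕ → Set
GoodRuns k j rs = All (_≤ k) rs × finalRunLength rs ≤ j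

goodRuns-extendLast : {k j : ℕ} (rs : List ℕ) → 1 ≤ j → j ≤ k →
                      GoodRuns k j (extendLast rs) ⇔ GoodRuns k (j ∸ 1) rs
goodRuns-extendLast {k} {suc j} rs _ j≤k = mk⇔
  (λ (ext , fin) → proj₁ (all-extendLast⁻ rs ext) , ≤-pred (subst (_≤ suc j) (finalRunLength-extendLast rs) fin))
  (λ (runs , fin) → all-extendLast⁺ rs runs (≤-trans (s≤s fin) j≤k)
                  , subst (_≤ suc j) (sym (finalRunLength-extendLast rs)) (s≤s fin))

goodRuns-++ : {k j : ℕ} (rs ss : List ℕ) → 1 ≤ k → ss ≢ [] →
              GoodRuns k j (extendLast rs ++ ss) ⇔ (GoodRuns k (k ∸ 1) rs × GoodRuns k j ss)
goodRuns-++ {suc k} {j} rs ss _ ss≢[] = mk⇔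
  (λ (all , fin) → let (ext , all-ss) = All.++⁻ (extendLast rs) all ; (runs , room) = all-extendLast⁻ rs ext in
     (runs , ≤-pred room) , all-ss , subst (_≤ j) fin-eq fin)
  (λ ((runs , room) , all-ss , fin) →
     All.++⁺ (all-extendLast⁺ rs runs (s≤s room)) all-ss , subst (_≤ j) (sym fin-eq) fin)
  where fin-eq = finalRunLength-++ (extendLast rs) ss ss≢[]

runLengths-nonempty : (w : List ℕ) → w ≢ [] → runLengths w ≢ []
runLengths-nonempty []      w≢[] = ⊥-elim (w≢[] refl)
runLengths-nonempty (y ∷ w) _    = runsFrom-nonempty y 1 w

good-append-max : {k j m : ℕ} (a : List ℕ) → 1 ≤ j → j ≤ k → All (_< m) a →
                  Good k j (a ++ m ∷ []) ⇔ Good k (j ∸ 1) a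
good-append-max {k} {j} a 1≤j j≤k a<m =
  subst (λ rs → GoodRuns k j rs ⇔ Good k (j ∸ 1) a)
        (sym (trans (runLengths-insert-max a [] a<m []) (++-identityʳ _)))
        (goodRuns-extendLast (runLengths a) 1≤j j≤k)

good-insert-max : {k j m : ℕ} (a b : List ℕ) → 1 ≤ k → b ≢ [] → All (_< m) a → All (_< m) b →
                  Good k j (a ++ m ∷ b) ⇔ (Good k (k ∸ 1) a × Good k j b)
good-insert-max {k} {j} a b 1≤k b≢[] a<m b<m =
  subst (λ rs → GoodRuns k j rs ⇔ (Good k (k ∸ 1) a × Good k j b))
        (sym (runLengths-insert-max a b a<m b<m))
        (goodRuns-++ (runLengths a) (runLengths b) 1≤k (runLengths-nonempty b b≢[]))

finalRunLength-runsFrom : (p l : ℕ) (xs : List ℕ) → 1 ≤ l → 1 ≤ finalRunLength (runsFrom p l xs)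
finalRunLength-runsFrom p l []       1≤l = 1≤l
finalRunLength-runsFrom p l (y ∷ ys) 1≤l with p <ᵇ y
... | true  = finalRunLength-runsFrom y (suc l) ys (s≤s z≤n)
... | false = subst (1 ≤_) (sym (finalRunLength-++ [ l ] _ (runsFrom-nonempty y 1 ys)))
                    (finalRunLength-runsFrom y 1 ys (s≤s z≤n))

not-good-0 : {k : ℕ} (w : List ℕ) → w ≢ [] → ¬ Good k 0 w
not-good-0 []      w≢[] _         = w≢[] refl
not-good-0 (x ∷ w) _    (_ , fin) = 1+n≰n (≤-trans (finalRunLength-runsFrom x 1 w (s≤s z≤n)) fin)

goodCount : ℕ → ℕ → List ℕ → ℕ
goodCount k j xs = count (good? k j) (arrangements xs)

-- Relabelling the entries of xs by a map φ that is strictly increasing on xs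
-- preserves run lengths and distinctness of words, hence the good count.
module Relabel (φ : ℕ → ℕ) (xs : List ℕ)
               (φ-mono : ∀ {a b} → a ∈ xs → b ∈ xs → a < b → φ a < φ b) where

  <ᵇ-φ : {p y : ℕ} → p ∈ xs → y ∈ xs → (φ p <ᵇ φ y) ≡ (p <ᵇ y)
  <ᵇ-φ {p} {y} p∈ y∈ with <-cmp p y
  ... | tri< p<y _ _    = trans (<ᵇ-true (φ-mono p∈ y∈ p<y)) (sym (<ᵇ-true p<y))
  ... | tri≈ _ refl _   = trans (<ᵇ-false {φ p} ≤-refl) (sym (<ᵇ-false {p} ≤-refl))
  ... | tri> _ _ y<p    = trans (<ᵇ-false (<⇒≤ (φ-mono y∈ p∈ y<p))) (sym (<ᵇ-false (<⇒≤ y<p)))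

  runsFrom-φ : (p l : ℕ) (w : List ℕ) → p ∈ xs → All (_∈ xs) w → runsFrom (φ p) l (map φ w) ≡ runsFrom p l w
  runsFrom-φ p l []      _  _            = refl
  runsFrom-φ p l (y ∷ w) p∈ (y∈ ∷ w⊆xs) rewrite <ᵇ-φ p∈ y∈ with p <ᵇ y
  ... | true  = runsFrom-φ y (suc l) w y∈ w⊆xs
  ... | false = cong (l ∷_) (runsFrom-φ y 1 w y∈ w⊆xs)

  runLengths-φ : (w : List ℕ) → All (_∈ xs) w → runLengths (map φ w) ≡ runLengths w
  runLengths-φ []      _            = refl
  runLengths-φ (y ∷ w) (y∈ ∷ w⊆xs) = runsFrom-φ y 1 w y∈ w⊆xs

  φ-injective : {a b : ℕ} → a ∈ xs → b ∈ xs → φ a ≡ φ b → a ≡ b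
  φ-injective {a} {b} a∈ b∈ φa≡φb with <-cmp a b
  ... | tri< a<b _ _ = ⊥-elim (<⇒≢ (φ-mono a∈ b∈ a<b) φa≡φb)
  ... | tri≈ _ a≡b _ = a≡b
  ... | tri> _ _ b<a = ⊥-elim (<⇒≢ (φ-mono b∈ a∈ b<a) (sym φa≡φb))

  unique-φ : (w : List ℕ) → All (_∈ xs) w → Unique w → Unique (map φ w)
  unique-φ []      _            _             = []
  unique-φ (y ∷ w) (y∈ ∷ w⊆xs) (y∉w ∷ u) =
    All.map⁺ (All.tabulate λ z∈w → All.lookup y∉w z∈w ∘ φ-injective y∈ (All.lookup w⊆xs z∈w))
    ∷ unique-φ w w⊆xs u

  words-φ : (n : ℕ) → words (map φ xs) n ≡ map (map φ) (words xs n)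
  words-φ zero    = refl
  words-φ (suc n) = begin
    concatMap (λ y → map (y ∷_) (words (map φ xs) n)) (map φ xs)
      ≡⟨ concatMap-map _ φ xs ⟩
    concatMap (λ x → map (φ x ∷_) (words (map φ xs) n)) xs
      ≡⟨ concatMap-cong (λ x → cong (map (φ x ∷_)) (words-φ n)) xs ⟩
    concatMap (λ x → map (φ x ∷_) (map (map φ) (words xs n))) xs
      -- both sides send a word w to φ x ∷ map φ w
      ≡⟨ concatMap-cong (λ x → trans (sym (map-∘ (words xs n))) (map-∘ (words xs n))) xs ⟩
    concatMap (λ x → map (map φ) (map (x ∷_) (words xs n))) xs
      ≡⟨ sym (map-concatMap (map φ) (λ x → map (x ∷_) (words xs n)) xs) ⟩
    map (map φ) (concatMap (λ x → map (x ∷_) (words xs n)) xs) ∎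
    where open ≡-Reasoning

  goodCount-φ : (k j : ℕ) → goodCount k j (map φ xs) ≡ goodCount k j xs
  goodCount-φ k j = begin
    count (good? k j) (filter unique? (words (map φ xs) (length (map φ xs))))
      ≡⟨ cong (λ W → count (good? k j) (filter unique? W)) (trans (cong (words (map φ xs)) (length-map φ xs)) (words-φ (length xs))) ⟩
    count (good? k j) (filter unique? (map (map φ) W))
      ≡⟨ count-filter unique? (good? k j) (map (map φ) W) ⟩
    count (unique? ∩? good? k j) (map (map φ) W)
      ≡⟨ count-map (unique? ∩? good? k j) (map φ) W ⟩
    count ((unique? ∩? good? k j) ∘ map φ) W
      ≡⟨ count-cong _ _ W relabel-⇔ ⟩
    count (unique? ∩? good? k j) W
      ≡⟨ sym (count-filter unique? (good? k j) W) ⟩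
    count (good? k j) (filter unique? W) ∎
    where
    open ≡-Reasoning
    W = words xs (length xs)
    relabel-⇔ : ∀ {w} → w ∈ W → (Unique (map φ w) × Good k j (map φ w)) ⇔ (Unique w × Good k j w)
    relabel-⇔ {w} w∈ = mk⇔ (λ (u , g) → Unique.map⁻ u , subst (GoodRuns k j) runs-eq g)
                           (λ (u , g) → unique-φ w w⊆xs u , subst (GoodRuns k j) (sym runs-eq) g)
      where
      w⊆xs = proj₂ (∈-words⁻ xs (length xs) w∈)
      runs-eq = runLengths-φ w w⊆xs

-- The entry of a list at position i, counting from 0 (and 0 past its end).
entry : List ℕ → ℕ → ℕ
entry []       i       = 0
entry (y ∷ ys) zero    = y
entry (y ∷ ys) (suc i) = entry ys i

entry-∈ : (ys : List ℕ) (i : ℕ) → i < length ys → entry ys i ∈ ys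
entry-∈ (y ∷ ys) zero    _         = here refl
entry-∈ (y ∷ ys) (suc i) (s≤s i<n) = there (entry-∈ ys i i<n)

entry-mono : (ys : List ℕ) → AllPairs _<_ ys → {i i′ : ℕ} → i < i′ → i′ < length ys → entry ys i < entry ys i′
entry-mono (y ∷ ys) (y<ys ∷ _)      {zero}  {suc i′} _          (s≤s i′<n) = All.lookup y<ys (entry-∈ ys i′ i′<n)
entry-mono (y ∷ ys) (_ ∷ ys-sorted) {suc i} {suc i′} (s≤s i<i′) (s≤s i′<n) = entry-mono ys ys-sorted i<i′ i′<n

applyUpTo-entry : (ys : List ℕ) → applyUpTo (entry ys) (length ys) ≡ ys
applyUpTo-entry []       = refl
applyUpTo-entry (y ∷ ys) = cong (y ∷_) (applyUpTo-entry ys)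

-- A strictly increasing list is an increasing relabelling of oneTo of its
-- length, so it has as many good arrangements.
goodCount-sorted : (k j : ℕ) (ys : List ℕ) → AllPairs _<_ ys → goodCount k j ys ≡ goodCount k j (oneTo (length ys))
goodCount-sorted k j ys ys-sorted =
  trans (cong (goodCount k j) (sym relabelled)) (Relabel.goodCount-φ φ (oneTo n) φ-mono k j)
  where
  n = length ys
  φ : ℕ → ℕ
  φ t = entry ys (t ∸ 1)
  relabelled : map φ (oneTo n) ≡ ys
  relabelled = trans (sym (map-∘ (upTo n))) (trans (map-upTo (entry ys) n) (applyUpTo-entry ys))
  φ-mono : ∀ {a b} → a ∈ oneTo n → b ∈ oneTo n → a < b → φ a < φ b
  φ-mono {suc a} {suc b} _ b∈ (s≤s a<b) = entry-mono ys ys-sorted a<b (proj₂ (∈-oneTo⁻ b∈))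
  φ-mono {zero}          a∈ _ _ = ⊥-elim (1+n≰n (proj₁ (∈-oneTo⁻ a∈)))
  φ-mono {suc a} {zero}  _ b∈ _ = ⊥-elim (1+n≰n (proj₁ (∈-oneTo⁻ b∈)))

data Split {A : Set} : List A → List A → List A → Set where
  []    : Split [] [] []
  left  : {x : A} {xs L R : List A} → Split xs L R → Split (x ∷ xs) (x ∷ L) R
  right : {x : A} {xs L R : List A} → Split xs L R → Split (x ∷ xs) L (x ∷ R)

splitsOf : ℕ → List A → List (List A × List A)
splitsOf zero    xs       = ([] , xs) ∷ []
splitsOf (suc i) []       = []
splitsOf (suc i) (x ∷ xs) = map (λ (L , R) → x ∷ L , R) (splitsOf i xs)
                         ++ map (λ (L , R) → L , x ∷ R) (splitsOf (suc i) xs)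

split-all-right : (xs : List A) → Split xs [] xs
split-all-right []       = []
split-all-right (x ∷ xs) = right (split-all-right xs)

split-[]-right : {xs R : List A} → Split xs [] R → R ≡ xs
split-[]-right []        = refl
split-[]-right (right s) = cong (_ ∷_) (split-[]-right s)

∈-splitsOf⁻ : (i : ℕ) (xs : List A) {L R : List A} → (L , R) ∈ splitsOf i xs → Split xs L R × length L ≡ i
∈-splitsOf⁻ zero    xs       (here refl) = split-all-right xs , refl
∈-splitsOf⁻ (suc i) (x ∷ xs) LR∈ with ∈-++⁻ (map _ (splitsOf i xs)) LR∈
... | inj₁ LR∈ˡ with _ , LR′∈ , refl ← ∈-map⁻ _ LR∈ˡ =
  let (s , len) = ∈-splitsOf⁻ i xs LR′∈ in left s , cong suc len
... | inj₂ LR∈ʳ with _ , LR′∈ , refl ← ∈-map⁻ _ LR∈ʳ =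
  let (s , len) = ∈-splitsOf⁻ (suc i) xs LR′∈ in right s , len

∈-splitsOf⁺ : {xs L R : List A} → Split xs L R → (L , R) ∈ splitsOf (length L) xs
∈-splitsOf⁺ []                       = here refl
∈-splitsOf⁺ (left s)                 = ∈-++⁺ˡ (∈-map⁺ _ (∈-splitsOf⁺ s))
∈-splitsOf⁺ (right {L = []} s)       rewrite split-[]-right s = here refl
∈-splitsOf⁺ {xs = x ∷ xs} (right {L = _ ∷ L} s) = ∈-++⁺ʳ (map _ (splitsOf (length L) xs)) (∈-map⁺ _ (∈-splitsOf⁺ s))

split-length : {xs L R : List A} → Split xs L R → length L + length R ≡ length xs
split-length []        = refl
split-length (left s)  = cong suc (split-length s)
split-length {L = L} (right {R = R} s) = trans (+-suc (length L) (length R)) (cong suc (split-length s))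

split-⊆ˡ : {xs L R : List A} → Split xs L R → L ⊆ xs
split-⊆ˡ (left s)  (here refl) = here refl
split-⊆ˡ (left s)  (there y∈)  = there (split-⊆ˡ s y∈)
split-⊆ˡ (right s) y∈          = there (split-⊆ˡ s y∈)

split-⊆ʳ : {xs L R : List A} → Split xs L R → R ⊆ xs
split-⊆ʳ (right s) (here refl) = here refl
split-⊆ʳ (right s) (there y∈)  = there (split-⊆ʳ s y∈)
split-⊆ʳ (left s)  y∈          = there (split-⊆ʳ s y∈)

split-sorted : {_~_ : A → A → Set} {xs L R : List A} → AllPairs _~_ xs → Split xs L R → AllPairs _~_ L × AllPairs _~_ R
split-sorted []             []        = [] , []
split-sorted (x~xs ∷ sorted) (left s)  =
  let (L-sorted , R-sorted) = split-sorted sorted s in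
  All.tabulate (All.lookup x~xs ∘ split-⊆ˡ s) ∷ L-sorted , R-sorted
split-sorted (x~xs ∷ sorted) (right s) =
  let (L-sorted , R-sorted) = split-sorted sorted s in
  L-sorted , All.tabulate (All.lookup x~xs ∘ split-⊆ʳ s) ∷ R-sorted

split-disjoint : {xs L R : List A} → Unique xs → Split xs L R → {y : A} → y ∈ L → y ∈ R → ⊥
split-disjoint (x∉xs ∷ _) (left s)  (here refl) y∈R         = All.lookup x∉xs (split-⊆ʳ s y∈R) refl
split-disjoint (_ ∷ u)    (left s)  (there y∈L) y∈R         = split-disjoint u s y∈L y∈R
split-disjoint (x∉xs ∷ _) (right s) y∈L         (here refl) = All.lookup x∉xs (split-⊆ˡ s y∈L) refl
split-disjoint (_ ∷ u)    (right s) y∈L         (there y∈R) = split-disjoint u s y∈L y∈R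

split-determined : {xs L R L′ R′ : List A} → Unique xs → Split xs L R → Split xs L′ R′ →
                   L ⊆ L′ → L′ ⊆ L → L ≡ L′ × R ≡ R′
split-determined _ [] [] _ _ = refl , refl
split-determined (x∉xs ∷ u) (left s) (left s′) L⊆L′ L′⊆L =
  let (L≡ , R≡) = split-determined u s s′ (shrink s L⊆L′) (shrink s′ L′⊆L) in cong (_ ∷_) L≡ , R≡
  where
  -- x occurs only at the head, so it can be dropped from both sides
  shrink : ∀ {L₁ R₁ L₂} → Split _ L₁ R₁ → (_ ∷ L₁) ⊆ (_ ∷ L₂) → L₁ ⊆ L₂
  shrink s₁ ⊆₁₂ y∈ with ⊆₁₂ (there y∈)
  ... | here refl = ⊥-elim (All.lookup x∉xs (split-⊆ˡ s₁ y∈) refl)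
  ... | there y∈′ = y∈′
split-determined (x∉xs ∷ _) (left s)  (right s′) L⊆L′ _   = ⊥-elim (All.lookup x∉xs (split-⊆ˡ s′ (L⊆L′ (here refl))) refl)
split-determined (x∉xs ∷ _) (right s) (left s′)  _   L′⊆L = ⊥-elim (All.lookup x∉xs (split-⊆ˡ s (L′⊆L (here refl))) refl)
split-determined (_ ∷ u)    (right s) (right s′) L⊆L′ L′⊆L =
  let (L≡ , R≡) = split-determined u s s′ L⊆L′ L′⊆L in L≡ , cong (_ ∷_) R≡

split-filter : {P : A → Set} (P? : Decidable P) (xs : List A) → Split xs (filter P? xs) (filter (¬? ∘ P?) xs)
split-filter P? []       = []
split-filter P? (x ∷ xs) with P? x
... | yes _ = left (split-filter P? xs)
... | no  _ = right (split-filter P? xs)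

splitsOf-unique : (i : ℕ) (xs : List A) → Unique xs → Unique (splitsOf i xs)
splitsOf-unique zero    xs       _ = [] ∷ []
splitsOf-unique (suc i) []       _ = []
splitsOf-unique (suc i) (x ∷ xs) (x∉xs ∷ u) =
  Unique.++⁺ (Unique.map⁺ cons-left-injective (splitsOf-unique i xs u))
             (Unique.map⁺ cons-right-injective (splitsOf-unique (suc i) xs u))
             (λ (v∈ˡ , v∈ʳ) → halves-disjoint v∈ˡ v∈ʳ)
  where
  cons-left-injective : ∀ {p q : List _ × List _} → (x ∷ proj₁ p , proj₂ p) ≡ (x ∷ proj₁ q , proj₂ q) → p ≡ q
  cons-left-injective refl = refl
  cons-right-injective : ∀ {p q : List _ × List _} → (proj₁ p , x ∷ proj₂ p) ≡ (proj₁ q , x ∷ proj₂ q) → p ≡ q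
  cons-right-injective refl = refl
  -- the left part of a split in the first block contains x, in the second it does not
  halves-disjoint : ∀ {v} → v ∈ map _ (splitsOf i xs) → v ∈ map _ (splitsOf (suc i) xs) → ⊥
  halves-disjoint v∈ˡ v∈ʳ with _ , _ , refl ← ∈-map⁻ _ v∈ˡ | _ , LR∈ , v≡ ← ∈-map⁻ _ v∈ʳ =
    All.lookup x∉xs (split-⊆ˡ (proj₁ (∈-splitsOf⁻ (suc i) xs LR∈)) (subst (x ∈_) (cong proj₁ v≡) (here refl))) refl

-- Pascal's rule gives the number of splits with i elements on the left.
length-splitsOf : (i : ℕ) (xs : List A) → length (splitsOf i xs) ≡ length xs C i
length-splitsOf zero    xs       = refl
length-splitsOf (suc i) []       = refl
length-splitsOf (suc i) (x ∷ xs) = begin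
  length (map _ (splitsOf i xs) ++ map _ (splitsOf (suc i) xs))
    ≡⟨ length-++ (map _ (splitsOf i xs)) ⟩
  length (map _ (splitsOf i xs)) + length (map _ (splitsOf (suc i) xs))
    ≡⟨ cong₂ _+_ (trans (length-map _ (splitsOf i xs)) (length-splitsOf i xs))
                 (trans (length-map _ (splitsOf (suc i) xs)) (length-splitsOf (suc i) xs)) ⟩
  length xs C i + length xs C (suc i)
    ≡⟨ nCk+nC[k+1]≡[n+1]C[k+1] (length xs) i ⟩
  suc (length xs) C (suc i) ∎
  where open ≡-Reasoning

-- The number of ways to fill a split of sizes (i, r) around the maximum:
-- for r = 0 the left part must be good for (k, j-1); for r > 0 the left
-- part must be good for (k, k-1) and the right part good for (k, j).
blockCount : ℕ → ℕ → ℕ → ℕ → ℕ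
blockCount k j i zero    = goodCount k (j ∸ 1) (oneTo i)
blockCount k j i (suc r) = goodCount k (k ∸ 1) (oneTo i) * goodCount k j (oneTo (suc r))

module Decomposition (xs : List ℕ) (xs-sorted : AllPairs _<_ xs) (m : ℕ) (xs<m : All (_< m) xs) where

  xs-unique : Unique xs
  xs-unique = sorted⇒unique xs-sorted

  m∉ : {ys : List ℕ} → ys ⊆ xs → m ∉ ys
  m∉ ys⊆xs m∈ys = <-irrefl refl (All.lookup xs<m (ys⊆xs m∈ys))

  below-m : {ys : List ℕ} → ys ⊆ xs → All (_< m) ys
  below-m ys⊆xs = All.tabulate (All.lookup xs<m ∘ ys⊆xs)

  ∈-xs : {y : ℕ} → y ∈ xs ++ [ m ] → y ≢ m → y ∈ xs
  ∈-xs y∈ y≢m with ∈-++⁻ xs y∈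
  ... | inj₁ y∈xs        = y∈xs
  ... | inj₂ (here refl) = ⊥-elim (y≢m refl)

  glue : List ℕ → List ℕ → List ℕ
  glue a b = a ++ m ∷ b

  glue-arrangement : {L R a b : List ℕ} → Split xs L R → IsArrangement L a → IsArrangement R b →
                     IsArrangement (xs ++ [ m ]) (glue a b)
  glue-arrangement {L} {R} {a} {b} s arr-a arr-b = record
    { distinct   = Unique.++⁺ (IsArrangement.distinct arr-a) (m∉b ∷ IsArrangement.distinct arr-b) a#mb
    ; within     = within
    ; sameLength = begin
        length (a ++ m ∷ b)        ≡⟨ length-++ a ⟩
        length a + suc (length b)  ≡⟨ cong₂ (λ p q → p + suc q) (IsArrangement.sameLength arr-a) (IsArrangement.sameLength arr-b) ⟩
        length L + suc (length R)  ≡⟨ +-suc (length L) (length R) ⟩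
        suc (length L + length R)  ≡⟨ cong suc (split-length s) ⟩
        suc (length xs)            ≡⟨ sym (trans (length-++ xs) (+-comm (length xs) 1)) ⟩
        length (xs ++ [ m ])       ∎ }
    where
    open ≡-Reasoning
    a⊆xs : a ⊆ xs
    a⊆xs = split-⊆ˡ s ∘ IsArrangement.within arr-a
    b⊆xs : b ⊆ xs
    b⊆xs = split-⊆ʳ s ∘ IsArrangement.within arr-b
    m∉b : All (m ≢_) b
    m∉b = All.tabulate λ { y∈b refl → m∉ b⊆xs y∈b }
    a#mb : ∀ {y} → ¬ (y ∈ a × y ∈ m ∷ b)
    a#mb (y∈a , here refl) = m∉ a⊆xs y∈a
    a#mb (y∈a , there y∈b) = split-disjoint xs-unique s (IsArrangement.within arr-a y∈a) (IsArrangement.within arr-b y∈b)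
    within : a ++ m ∷ b ⊆ xs ++ [ m ]
    within y∈ with ∈-++⁻ a y∈
    ... | inj₁ y∈a         = ∈-++⁺ˡ (a⊆xs y∈a)
    ... | inj₂ (here refl) = ∈-++⁺ʳ xs (here refl)
    ... | inj₂ (there y∈b) = ∈-++⁺ˡ (b⊆xs y∈b)

  record Unglued (w : List ℕ) : Set where
    field
      {before after L R} : List ℕ
      cut        : w ≡ glue before after
      split      : Split xs L R
      before-arr : IsArrangement L before
      after-arr  : IsArrangement R after

  unglue : {w : List ℕ} → IsArrangement (xs ++ [ m ]) w → Unglued w
  unglue {w} arr with a , b , refl ← ∈-∃++ (arrangement-covers arr (∈-++⁺ʳ xs (here refl))) = record
    { cut        = refl
    ; split      = split-filter in-a? xs
    ; before-arr = record
      { distinct = a-unique ; within = a⊆L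
      ; sameLength = unique-≋-length a-unique (Unique.filter⁺ in-a? xs-unique) a⊆L (proj₂ ∘ ∈-filter⁻ in-a? {xs = xs}) }
    ; after-arr  = record
      { distinct = b-unique ; within = b⊆R
      ; sameLength = unique-≋-length b-unique (Unique.filter⁺ (¬? ∘ in-a?) xs-unique) b⊆R R⊆b } }
    where
    open IsArrangement arr
    open import Data.List.Membership.DecPropositional _≟_ using (_∈?_)
    -- the split of xs into the entries inside and outside a
    in-a? : Decidable (_∈ a)
    in-a? y = y ∈? a
    parts = unique-++⁻ a distinct
    a-unique = proj₁ parts
    m∉b : All (m ≢_) b
    m∉b with _ , m∉b ∷ _ , _ ← parts = m∉b
    b-unique : Unique b
    b-unique with _ , _ ∷ b-unique , _ ← parts = b-unique
    a#mb = proj₂ (proj₂ parts)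
    a⊆L : a ⊆ filter in-a? xs
    a⊆L y∈a = ∈-filter⁺ in-a? (∈-xs (within (∈-++⁺ˡ y∈a)) λ { refl → a#mb y∈a (here refl) }) y∈a
    b⊆R : b ⊆ filter (¬? ∘ in-a?) xs
    b⊆R y∈b = ∈-filter⁺ (¬? ∘ in-a?) (∈-xs (within (∈-++⁺ʳ a (there y∈b))) λ { refl → All.lookup m∉b y∈b refl })
                        (λ y∈a → a#mb y∈a (there y∈b))
    -- an entry of xs outside a lies in w but is not m, so it lies in b
    R⊆b : filter (¬? ∘ in-a?) xs ⊆ b
    R⊆b {y} y∈R with y∈xs , y∉a ← ∈-filter⁻ (¬? ∘ in-a?) {xs = xs} y∈R
                   with ∈-++⁻ a (arrangement-covers arr (∈-++⁺ˡ y∈xs))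
    ... | inj₁ y∈a         = ⊥-elim (y∉a y∈a)
    ... | inj₂ (here refl) = ⊥-elim (m∉ id y∈xs)
    ... | inj₂ (there y∈b) = y∈b

  splits : List (List ℕ × List ℕ)
  splits = concatMap (λ i → splitsOf i xs) (upTo (suc (length xs)))

  ∈-splits⁺ : {L R : List ℕ} → Split xs L R → (L , R) ∈ splits
  ∈-splits⁺ {L} {R} s = ∈-concatMap-intro (λ i → splitsOf i xs) (∈-upTo⁺ (s≤s L≤xs)) (∈-splitsOf⁺ s)
    where L≤xs = subst (length L ≤_) (split-length s) (m≤m+n (length L) (length R))

  ∈-splits⁻ : {L R : List ℕ} → (L , R) ∈ splits → Split xs L R
  ∈-splits⁻ LR∈ with i , _ , LR∈ᵢ ← ∈-concatMap-elim (λ i → splitsOf i xs) (upTo (suc (length xs))) LR∈ = proj₁ (∈-splitsOf⁻ i xs LR∈ᵢ)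

  splits-unique : Unique splits
  splits-unique = unique-concatMap (λ i → splitsOf i xs) (upTo (suc (length xs))) (Unique.upTo⁺ _)
    (λ {i} _ → splitsOf-unique i xs xs-unique)
    (λ {i} {i′} _ _ p∈ p∈′ → trans (sym (proj₂ (∈-splitsOf⁻ i xs p∈))) (proj₂ (∈-splitsOf⁻ i′ xs p∈′)))

  glue-cancel : {L L′ a b a′ b′ : List ℕ} → L ⊆ xs → L′ ⊆ xs → a ∈ arrangements L → a′ ∈ arrangements L′ →
                glue a b ≡ glue a′ b′ → a ≡ a′ × b ≡ b′
  glue-cancel L⊆xs L′⊆xs a∈ a′∈ eq = ++-∷-cancel _ _ _ _ eq
    (m∉ (L⊆xs ∘ IsArrangement.within (∈-arrangements⁻ a∈))) (m∉ (L′⊆xs ∘ IsArrangement.within (∈-arrangements⁻ a′∈)))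

  module _ (k j : ℕ) where

    block : List ℕ × List ℕ → List (List ℕ)
    block (L , R) = filter (good? k j) (concatMap (λ a → map (glue a) (arrangements R)) (arrangements L))

    decomposed : List (List ℕ)
    decomposed = concatMap block splits

    ∈-block⁻ : (L R : List ℕ) {w : List ℕ} → w ∈ block (L , R) →
               ∃₂ λ a b → a ∈ arrangements L × b ∈ arrangements R × w ≡ glue a b × Good k j w
    ∈-block⁻ L R w∈ with w∈glued , good ← ∈-filter⁻ (good? k j) w∈
      with a , a∈ , w∈ₐ ← ∈-concatMap-elim (λ a → map (glue a) (arrangements R)) (arrangements L) w∈glued
      with b , b∈ , w≡ ← ∈-map⁻ (glue a) w∈ₐ = a , b , a∈ , b∈ , w≡ , good

    decomposed⊆good : decomposed ⊆ filter (good? k j) (arrangements (xs ++ [ m ]))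
    decomposed⊆good w∈ with (L , R) , LR∈ , w∈block ← ∈-concatMap-elim block splits w∈
      with a , b , a∈ , b∈ , refl , good ← ∈-block⁻ L R w∈block =
      ∈-filter⁺ (good? k j) (∈-arrangements⁺ (glue-arrangement (∈-splits⁻ LR∈) (∈-arrangements⁻ a∈) (∈-arrangements⁻ b∈))) good

    good⊆decomposed : filter (good? k j) (arrangements (xs ++ [ m ])) ⊆ decomposed
    good⊆decomposed w∈ with w∈arr , good ← ∈-filter⁻ (good? k j) w∈ with unglue (∈-arrangements⁻ w∈arr)
    ... | record { cut = refl ; split = s ; before-arr = arr-a ; after-arr = arr-b } =
      ∈-concatMap-intro block (∈-splits⁺ s)
        (∈-filter⁺ (good? k j) (∈-concatMap-intro _ (∈-arrangements⁺ arr-a) (∈-map⁺ _ (∈-arrangements⁺ arr-b))) good)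

    block-unique : {L R : List ℕ} → Split xs L R → Unique (block (L , R))
    block-unique {L} {R} s = Unique.filter⁺ (good? k j)
      (unique-concatMap (λ a → map (glue a) (arrangements R)) (arrangements L) (arrangements-unique L L-unique)
        (λ {a} _ → Unique.map⁺ (λ eq → ∷-injectiveʳ (++-cancelˡ a _ _ eq)) (arrangements-unique R R-unique))
        (λ {a} {a′} a∈ a′∈ w∈ w∈′ → let (_ , _ , w≡) = ∈-map⁻ (glue a) w∈ ; (_ , _ , w≡′) = ∈-map⁻ (glue a′) w∈′ in
           proj₁ (glue-cancel (split-⊆ˡ s) (split-⊆ˡ s) a∈ a′∈ (trans (sym w≡) w≡′))))
      where
      L-unique = sorted⇒unique (proj₁ (split-sorted xs-sorted s))
      R-unique = sorted⇒unique (proj₂ (split-sorted xs-sorted s))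

    -- A word lies in the block of only one split: its part before m
    -- determines the left part of the split.
    blocks-disjoint : {p p′ : List ℕ × List ℕ} {w : List ℕ} → p ∈ splits → p′ ∈ splits →
                      w ∈ block p → w ∈ block p′ → p ≡ p′
    blocks-disjoint {L , R} {L′ , R′} p∈ p′∈ w∈ w∈′
      with a , b , a∈ , _ , refl , _ ← ∈-block⁻ L R w∈ | a′ , b′ , a′∈ , _ , w≡′ , _ ← ∈-block⁻ L′ R′ w∈′
      with refl , _ ← glue-cancel (split-⊆ˡ (∈-splits⁻ p∈)) (split-⊆ˡ (∈-splits⁻ p′∈)) a∈ a′∈ w≡′ =
      let (L≡ , R≡) = split-determined xs-unique (∈-splits⁻ p∈) (∈-splits⁻ p′∈) (members {L} {L′} a∈ a′∈) (members {L′} {L} a′∈ a∈)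
      in cong₂ _,_ L≡ R≡
      where
      members : ∀ {L₁ L₂ c} → c ∈ arrangements L₁ → c ∈ arrangements L₂ → L₁ ⊆ L₂
      members {L₁} {L₂} c∈₁ c∈₂ = IsArrangement.within (∈-arrangements⁻ c∈₂) ∘ arrangement-covers (∈-arrangements⁻ c∈₁)

    decomposed-unique : Unique decomposed
    decomposed-unique = unique-concatMap block splits splits-unique
      (λ {p} p∈ → block-unique (∈-splits⁻ p∈)) (λ {p} {p′} p∈ p′∈ → blocks-disjoint {p} {p′} p∈ p′∈)

    module _ (1≤k : 1 ≤ k) (1≤j : 1 ≤ j) (j≤k : j ≤ k) where

      block-count : {L R : List ℕ} → Split xs L R → length (block (L , R)) ≡ blockCount k j (length L) (length R)
      block-count {L} {[]} s = begin
        count (good? k j) (concatMap (λ a → map (glue a) (arrangements [])) (arrangements L))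
          ≡⟨ count-product (good? k j) (good? k (j ∸ 1)) U? glue (arrangements L) (arrangements []) glue-good ⟩
        goodCount k (j ∸ 1) L * 1
          ≡⟨ *-identityʳ _ ⟩
        goodCount k (j ∸ 1) L
          ≡⟨ goodCount-sorted k (j ∸ 1) L (proj₁ (split-sorted xs-sorted s)) ⟩
        goodCount k (j ∸ 1) (oneTo (length L)) ∎
        where
        open ≡-Reasoning
        glue-good : ∀ {a b} → a ∈ arrangements L → b ∈ arrangements [] → Good k j (glue a b) ⇔ (Good k (j ∸ 1) a × ⊤)
        glue-good {a} {[]} a∈ _ =
          let a-good = good-append-max a 1≤j j≤k (below-m (split-⊆ˡ s ∘ IsArrangement.within (∈-arrangements⁻ a∈)))
          in mk⇔ (λ g → to a-good g , _) (from a-good ∘ proj₁)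
        glue-good {b = _ ∷ _} _ b∈ with () ← IsArrangement.sameLength (∈-arrangements⁻ {[]} b∈)
      block-count {L} {r ∷ R} s = begin
        count (good? k j) (concatMap (λ a → map (glue a) (arrangements (r ∷ R))) (arrangements L))
          ≡⟨ count-product (good? k j) (good? k (k ∸ 1)) (good? k j) glue (arrangements L) (arrangements (r ∷ R)) glue-good ⟩
        goodCount k (k ∸ 1) L * goodCount k j (r ∷ R)
          ≡⟨ cong₂ _*_ (goodCount-sorted k (k ∸ 1) L (proj₁ (split-sorted xs-sorted s)))
                       (goodCount-sorted k j (r ∷ R) (proj₂ (split-sorted xs-sorted s))) ⟩
        goodCount k (k ∸ 1) (oneTo (length L)) * goodCount k j (oneTo (length (r ∷ R))) ∎
        where
        open ≡-Reasoning
        glue-good : ∀ {a b} → a ∈ arrangements L → b ∈ arrangements (r ∷ R) → Good k j (glue a b) ⇔ (Good k (k ∸ 1) a × Good k j b)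
        glue-good {a} {[]} _ b∈ with () ← IsArrangement.sameLength (∈-arrangements⁻ {r ∷ R} b∈)
        glue-good {a} {b@(_ ∷ _)} a∈ b∈ =
          good-insert-max a b 1≤k (λ ()) (below-m (split-⊆ˡ s ∘ IsArrangement.within (∈-arrangements⁻ a∈)))
                                         (below-m (split-⊆ʳ s ∘ IsArrangement.within (∈-arrangements⁻ b∈)))

      length-decomposed : length decomposed ≡
                          sumOver (λ i → (length xs C i) * blockCount k j i (length xs ∸ i)) (upTo (suc (length xs)))
      length-decomposed = begin
        length (concatMap block splits)
          ≡⟨ length-concatMap block splits ⟩
        sumOver (length ∘ block) splits
          ≡⟨ sumOver-concatMap (length ∘ block) (λ i → splitsOf i xs) (upTo (suc (length xs))) ⟩
        sumOver (λ i → sumOver (length ∘ block) (splitsOf i xs)) (upTo (suc (length xs)))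
          ≡⟨ sumOver-cong _ _ (upTo (suc (length xs))) (λ {i} _ → size-class i) ⟩
        sumOver (λ i → (length xs C i) * blockCount k j i (length xs ∸ i)) (upTo (suc (length xs))) ∎
        where
        open ≡-Reasoning
        size-class : ∀ i → sumOver (length ∘ block) (splitsOf i xs) ≡ (length xs C i) * blockCount k j i (length xs ∸ i)
        size-class i = begin
          sumOver (length ∘ block) (splitsOf i xs) ≡⟨ sumOver-cong _ (λ _ → c) (splitsOf i xs) each ⟩
          sumOver (λ _ → c) (splitsOf i xs)        ≡⟨ sumOver-const c (splitsOf i xs) ⟩
          length (splitsOf i xs) * c               ≡⟨ cong (_* c) (length-splitsOf i xs) ⟩
          (length xs C i) * c                        ∎
          where
          c = blockCount k j i (length xs ∸ i)
          each : ∀ {p} → p ∈ splitsOf i xs → length (block p) ≡ c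
          each {L , R} p∈ with s , refl ← ∈-splitsOf⁻ i xs p∈ =
            trans (block-count s) (cong (blockCount k j (length L)) R-length)
            where
            R-length : length R ≡ length xs ∸ length L
            R-length = trans (sym (m+n∸m≡n (length L) (length R))) (cong (_∸ length L) (split-length s))

      goodCount-recurrence : goodCount k j (xs ++ [ m ]) ≡
                             sumOver (λ i → (length xs C i) * blockCount k j i (length xs ∸ i)) (upTo (suc (length xs)))
      goodCount-recurrence =
        trans (unique-≋-length (Unique.filter⁺ (good? k j) (arrangements-unique _ full-unique)) decomposed-unique
                               good⊆decomposed decomposed⊆good)
              length-decomposed
        where
        full-unique : Unique (xs ++ [ m ])
        full-unique = Unique.++⁺ xs-unique ([] ∷ []) λ { (m∈xs , here refl) → m∉ id m∈xs }

sumℕ : ℕ → (ℕ → ℕ) → ℕ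
sumℕ zero    f = f 0
sumℕ (suc n) f = sumℕ n f + f (suc n)

sumOver-upTo : (n : ℕ) (f : ℕ → ℕ) → sumOver f (upTo (suc n)) ≡ sumℕ n f
sumOver-upTo zero    f = +-identityʳ (f 0)
sumOver-upTo (suc n) f = begin
  sumOver f (upTo (suc (suc n)))              ≡⟨ cong (sumOver f) (sym (upTo-∷ʳ (suc n))) ⟩
  sumOver f (upTo (suc n) ++ [ suc n ])       ≡⟨ sumOver-++ f (upTo (suc n)) [ suc n ] ⟩
  sumOver f (upTo (suc n)) + (f (suc n) + 0)  ≡⟨ cong₂ _+_ (sumOver-upTo n f) (+-identityʳ (f (suc n))) ⟩
  sumℕ n f + f (suc n)                        ∎
  where open ≡-Reasoning

sumℕ-cong-interior : (n : ℕ) (f g : ℕ → ℕ) → (∀ i → 1 ≤ i → i ≤ n → f i ≡ g i) → sumℕ n f + g 0 ≡ sumℕ n g + f 0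
sumℕ-cong-interior zero    f g _     = +-comm (f 0) (g 0)
sumℕ-cong-interior (suc n) f g f≗g = begin
  sumℕ n f + f (suc n) + g 0  ≡⟨ cong (λ z → sumℕ n f + z + g 0) (f≗g (suc n) (s≤s z≤n) ≤-refl) ⟩
  sumℕ n f + g (suc n) + g 0  ≡⟨ swap-last (sumℕ n f) (g (suc n)) (g 0) ⟩
  sumℕ n f + g 0 + g (suc n)  ≡⟨ cong (_+ g (suc n)) (sumℕ-cong-interior n f g (λ i 1≤i i≤n → f≗g i 1≤i (m≤n⇒m≤1+n i≤n))) ⟩
  sumℕ n g + f 0 + g (suc n)  ≡⟨ swap-last (sumℕ n g) (f 0) (g (suc n)) ⟩
  sumℕ n g + g (suc n) + f 0  ∎
  where
  open ≡-Reasoning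
  swap-last : ∀ x y z → x + y + z ≡ x + z + y
  swap-last = solve-∀

-- Σ_{i=0}^{n} C(n,i) a_i b_{n-i}: the numerators of the coefficients of a
-- product of exponential generating functions.
binomialConvolution : ℕ → (ℕ → ℕ) → (ℕ → ℕ) → ℕ
binomialConvolution n a b = sumℕ n (λ i → (n C i) * (a i * b (n ∸ i)))

-- Ũ k j t: the numerator of the coefficient of x^t / t! in 𝒰 k j.
Ũ : ℕ → ℕ → ℕ → ℕ
Ũ k j zero    = 0
Ũ k j (suc t) = U k j (suc t)

U≡goodCount : (k j t : ℕ) → 1 ≤ t → U k j t ≡ goodCount k j (oneTo t)
U≡goodCount k (suc j) t _       = cong (count (good? k (suc j))) (permutations≡arrangements t)
U≡goodCount k zero    (suc t) _ = sym (count-none (good? k 0) _ λ {w} w∈ → not-good-0 w (nonempty w∈))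
  where
  nonempty : ∀ {w} → w ∈ arrangements (oneTo (suc t)) → w ≢ []
  nonempty w∈ refl with () ← IsArrangement.sameLength (∈-arrangements⁻ {oneTo (suc t)} w∈)

oneTo-suc : (n : ℕ) → oneTo (suc n) ≡ oneTo n ++ [ suc n ]
oneTo-suc n = trans (cong (map suc) (sym (upTo-∷ʳ n))) (map-++ suc (upTo n) [ n ])

goodCount-oneTo-suc : (k j n : ℕ) → 1 ≤ k → 1 ≤ j → j ≤ k →
  goodCount k j (oneTo (suc n)) ≡ sumℕ n (λ i → (n C i) * blockCount k j i (n ∸ i))
goodCount-oneTo-suc k j n 1≤k 1≤j j≤k = begin
  goodCount k j (oneTo (suc n))
    ≡⟨ cong (goodCount k j) (oneTo-suc n) ⟩
  goodCount k j (oneTo n ++ [ suc n ])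
    ≡⟨ Decomposition.goodCount-recurrence (oneTo n) (oneTo-sorted n) (suc n) below k j 1≤k 1≤j j≤k ⟩
  sumOver (λ i → (length (oneTo n) C i) * blockCount k j i (length (oneTo n) ∸ i)) (upTo (suc (length (oneTo n))))
    ≡⟨ cong (λ l → sumOver (λ i → (l C i) * blockCount k j i (l ∸ i)) (upTo (suc l))) (length-oneTo n) ⟩
  sumOver (λ i → (n C i) * blockCount k j i (n ∸ i)) (upTo (suc n))
    ≡⟨ sumOver-upTo n _ ⟩
  sumℕ n (λ i → (n C i) * blockCount k j i (n ∸ i)) ∎
  where
  open ≡-Reasoning
  below : All (_< suc n) (oneTo n)
  below = All.tabulate (s≤s ∘ proj₂ ∘ ∈-oneTo⁻)

-- The blocks with one side empty count U_j(n) and U_{j-1}(n) (the empty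
-- arrangement is good); the others count products of U's.
blockCount-left-empty : (k j n : ℕ) → 1 ≤ n → blockCount k j 0 n ≡ U k j n
blockCount-left-empty k j (suc n) 1≤n = trans (*-identityˡ _) (sym (U≡goodCount k j (suc n) 1≤n))

blockCount-right-empty : (k j n : ℕ) → 1 ≤ n → blockCount k j n 0 ≡ U k (j ∸ 1) n
blockCount-right-empty k j n 1≤n = sym (U≡goodCount k (j ∸ 1) n 1≤n)

blockCount-both : (k j i r : ℕ) → blockCount k j (suc i) (suc r) ≡ Ũ k (k ∸ 1) (suc i) * Ũ k j (suc r)
blockCount-both k j i r = sym (cong₂ _*_ (U≡goodCount k (k ∸ 1) (suc i) (s≤s z≤n)) (U≡goodCount k j (suc r) (s≤s z≤n)))

-- Separating the end terms i = 0 and i = n of the decomposition sum; the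
-- convolution of Ũ_{k-1} and Ũ_j has vanishing end terms (Ũ(0) = 0).
U-recurrence : (k j n : ℕ) → 1 ≤ k → 1 ≤ j → j ≤ k → 1 ≤ n →
  U k j (suc n) ≡ U k j n + U k (j ∸ 1) n + binomialConvolution n (Ũ k (k ∸ 1)) (Ũ k j)
U-recurrence k j n@(suc n′) 1≤k 1≤j j≤k 1≤n = begin
  U k j (suc n)                                  ≡⟨ U≡goodCount k j (suc n) (s≤s z≤n) ⟩
  goodCount k j (oneTo (suc n))                  ≡⟨ goodCount-oneTo-suc k j n 1≤k 1≤j j≤k ⟩
  sumℕ n′ g + g n                                ≡⟨ cong₂ _+_ (sym (+-identityʳ (sumℕ n′ g))) last-block ⟩
  sumℕ n′ g + w 0 + U k (j ∸ 1) n                ≡⟨ cong (_+ U k (j ∸ 1) n) (sumℕ-cong-interior n′ g w interior) ⟩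
  sumℕ n′ w + g 0 + U k (j ∸ 1) n                ≡⟨ cong (λ z → sumℕ n′ w + z + U k (j ∸ 1) n) first-block ⟩
  sumℕ n′ w + U k j n + U k (j ∸ 1) n            ≡⟨ rearrange (sumℕ n′ w) (U k j n) (U k (j ∸ 1) n) ⟩
  U k j n + U k (j ∸ 1) n + (sumℕ n′ w + 0)      ≡⟨ cong (λ z → U k j n + U k (j ∸ 1) n + (sumℕ n′ w + z)) (sym last-term) ⟩
  U k j n + U k (j ∸ 1) n + sumℕ n w             ∎
  where
  open ≡-Reasoning
  g w : ℕ → ℕ
  g i = (n C i) * blockCount k j i (n ∸ i)
  w i = (n C i) * (Ũ k (k ∸ 1) i * Ũ k j (n ∸ i))
  rearrange : ∀ a b c → a + b + c ≡ b + c + (a + 0)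
  rearrange = solve-∀
  first-block : g 0 ≡ U k j n
  first-block = trans (*-identityˡ _) (blockCount-left-empty k j n 1≤n)
  last-block : g n ≡ U k (j ∸ 1) n
  last-block = trans (cong₂ (λ c r → c * blockCount k j n r) (nCn≡1 n) (n∸n≡0 n))
                     (trans (*-identityˡ _) (blockCount-right-empty k j n 1≤n))
  last-term : w n ≡ 0
  last-term = trans (cong (λ r → (n C n) * (Ũ k (k ∸ 1) n * Ũ k j r)) (n∸n≡0 n))
                    (trans (cong ((n C n) *_) (*-zeroʳ (Ũ k (k ∸ 1) n))) (*-zeroʳ (n C n)))
  interior : ∀ i → 1 ≤ i → i ≤ n′ → g i ≡ w i
  interior i@(suc i′) _ i≤n′ = cong ((n C i) *_)
    (trans (cong (blockCount k j i) n∸i)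
      (trans (blockCount-both k j i′ (n′ ∸ i)) (cong (λ r → Ũ k (k ∸ 1) i * Ũ k j r) (sym n∸i))))
    where n∸i = +-∸-assoc 1 i≤n′

-- Rational identities are checked on unnormalised representatives.
toℚᵘ-/ : (a d : ℕ) → toℚᵘ (ℤ.+ a / suc d) ℚᵘ.≃ mkℚᵘ (ℤ.+ a) d
toℚᵘ-/ a d = ℚ.toℚᵘ-fromℚᵘ (mkℚᵘ (ℤ.+ a) d)

/-cross : (a b c d : ℕ) .{{_ : NonZero c}} .{{_ : NonZero d}} → a * d ≡ b * c → ℤ.+ a / c ≡ ℤ.+ b / d
/-cross a b (suc c) (suc d) ad≡bc = ℚ.toℚᵘ-injective
  (ℚᵘ.≃-trans (toℚᵘ-/ a c) (ℚᵘ.≃-trans (*≡* cross) (ℚᵘ.≃-sym (toℚᵘ-/ b d))))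
  where
  cross : ℤ.+ a ℤ.* ℤ.+ suc d ≡ ℤ.+ b ℤ.* ℤ.+ suc c
  cross = trans (sym (ℤ.pos-* a (suc d))) (trans (cong ℤ.+_ ad≡bc) (ℤ.pos-* b (suc c)))

/-+ : (a b d : ℕ) .{{_ : NonZero d}} → (ℤ.+ a / d) ℚ.+ (ℤ.+ b / d) ≡ ℤ.+ (a + b) / d
/-+ a b (suc d) = ℚ.toℚᵘ-injective
  (ℚᵘ.≃-trans (ℚ.toℚᵘ-homo-+ (ℤ.+ a / d′) (ℤ.+ b / d′))
    (ℚᵘ.≃-trans (ℚᵘ.+-cong (toℚᵘ-/ a d) (toℚᵘ-/ b d))
      (ℚᵘ.≃-trans (*≡* cross) (ℚᵘ.≃-sym (toℚᵘ-/ (a + b) d)))))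
  where
  d′ = suc d
  cross : (ℤ.+ a ℤ.* ℤ.+ d′ ℤ.+ ℤ.+ b ℤ.* ℤ.+ d′) ℤ.* ℤ.+ d′ ≡ ℤ.+ (a + b) ℤ.* ℤ.+ (d′ * d′)
  cross rewrite sym (ℤ.pos-* a d′) | sym (ℤ.pos-* b d′) | sym (ℤ.pos-+ (a * d′) (b * d′))
              | sym (ℤ.pos-* (a * d′ + b * d′) d′) | sym (ℤ.pos-* (a + b) (d′ * d′)) =
    cong ℤ.+_ (trans (cong (_* d′) (sym (*-distribʳ-+ d′ a b))) (*-assoc (a + b) d′ d′))

/-* : (a b c d : ℕ) .{{_ : NonZero c}} .{{_ : NonZero d}} →
      (ℤ.+ a / c) ℚ.* (ℤ.+ b / d) ≡ (ℤ.+ (a * b) / (c * d)) {{m*n≢0 c d}}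
/-* a b (suc c) (suc d) = ℚ.toℚᵘ-injective
  (ℚᵘ.≃-trans (ℚ.toℚᵘ-homo-* (ℤ.+ a / suc c) (ℤ.+ b / suc d))
    (ℚᵘ.≃-trans (ℚᵘ.*-cong (toℚᵘ-/ a c) (toℚᵘ-/ b d))
      (ℚᵘ.≃-trans (*≡* (cong (ℤ._* ℤ.+ (suc c * suc d)) (sym (ℤ.pos-* a b)))) (ℚᵘ.≃-sym (toℚᵘ-/ (a * b) _)))))

egf : ℕ → ℕ → ℚ
egf a t = (ℤ.+ a / t !) {{t !≢0}}

𝒰≡egf : (k j t : ℕ) → 𝒰 k j t ≡ egf (Ũ k j t) t
𝒰≡egf k j zero    = refl
𝒰≡egf k j (suc t) = refl

egf-+ : (a b t : ℕ) → egf a t ℚ.+ egf b t ≡ egf (a + b) t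
egf-+ a b t = /-+ a b (t !) {{t !≢0}}

egf-deriv : (n a : ℕ) → (ℤ.+ suc n / 1) ℚ.* egf a (suc n) ≡ egf a n
egf-deriv n a = trans (/-* (suc n) a 1 (suc n !) {{_}} {{suc n !≢0}})
                      (/-cross (suc n * a) a (1 * suc n !) (n !) {{m*n≢0 1 (suc n !) {{_}} {{suc n !≢0}}}} {{n !≢0}}
                               (rearrange (suc n) a (n !)))
  where
  rearrange : ∀ m a f → (m * a) * f ≡ a * (1 * (m * f))
  rearrange = solve-∀

egf-* : (a b n i : ℕ) → i ≤ n → egf a i ℚ.* egf b (n ∸ i) ≡ egf ((n C i) * (a * b)) n
egf-* a b n i i≤n = begin
  egf a i ℚ.* egf b (n ∸ i)
    ≡⟨ /-* a b (i !) ((n ∸ i) !) {{i !≢0}} {{(n ∸ i) !≢0}} ⟩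
  (ℤ.+ (a * b) / (i ! * (n ∸ i) !)) {{m*n≢0 (i !) ((n ∸ i) !) {{i !≢0}} {{(n ∸ i) !≢0}}}}
    ≡⟨ /-cross (a * b) ((n C i) * (a * b)) (i ! * (n ∸ i) !) (n !)
         {{m*n≢0 (i !) ((n ∸ i) !) {{i !≢0}} {{(n ∸ i) !≢0}}}} {{n !≢0}} cross ⟩
  egf ((n C i) * (a * b)) n ∎
  where
  open ≡-Reasoning
  binomial : (n C i) * (i ! * (n ∸ i) !) ≡ n !
  binomial = trans (cong (_* (i ! * (n ∸ i) !)) (nCk≡n!/k![n-k]! i≤n)) (m/n*n≡m {{_}} (k![n∸k]!∣n! i≤n))
  cross : (a * b) * n ! ≡ (n C i) * (a * b) * (i ! * (n ∸ i) !)
  cross = trans (cong ((a * b) *_) (sym binomial)) (rearrange (a * b) (n C i) (i ! * (n ∸ i) !))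
    where
    rearrange : ∀ x c p → x * (c * p) ≡ c * x * p
    rearrange = solve-∀

sumTo-cong : (n : ℕ) (f g : ℕ → ℚ) → (∀ i → i ≤ n → f i ≡ g i) → sumTo n f ≡ sumTo n g
sumTo-cong zero    f g f≗g = f≗g 0 z≤n
sumTo-cong (suc n) f g f≗g = cong₂ ℚ._+_ (sumTo-cong n f g (λ i i≤n → f≗g i (m≤n⇒m≤1+n i≤n))) (f≗g (suc n) ≤-refl)

sumTo-egf : (n t : ℕ) (f : ℕ → ℕ) → sumTo n (λ i → egf (f i) t) ≡ egf (sumℕ n f) t
sumTo-egf zero    t f = refl
sumTo-egf (suc n) t f = trans (cong (ℚ._+ egf (f (suc n)) t) (sumTo-egf n t f)) (egf-+ (sumℕ n f) (f (suc n)) t)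

egf-convolution : (n : ℕ) (a b : ℕ → ℕ) →
  sumTo n (λ i → egf (a i) i ℚ.* egf (b (n ∸ i)) (n ∸ i)) ≡ egf (binomialConvolution n a b) n
egf-convolution n a b =
  trans (sumTo-cong n _ _ (λ i i≤n → egf-* (a i) (b (n ∸ i)) n i i≤n)) (sumTo-egf n n _)

-- Coefficientwise: at x^0 both sides are U(1) = 1; at x^n with n ≥ 1 the
-- derivative has numerator U_j(n+1), given by the recurrence.
mainTheorem3 : (k j : ℕ) → 1 ≤ k → 1 ≤ j → j ≤ k →
  (n : ℕ) → deriv (𝒰 k j) n ≡ (oneS ⊕ 𝒰 k j ⊕ 𝒰 k (j ∸ 1) ⊕ (𝒰 k (k ∸ 1) ⊛ 𝒰 k j)) n
mainTheorem3 (suc k) (suc j) _ _ _ zero = refl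
mainTheorem3 k j 1≤k 1≤j j≤k n@(suc _) = begin
  deriv (𝒰 k j) n
    ≡⟨ egf-deriv n (U k j (suc n)) ⟩
  egf (U k j (suc n)) n
    ≡⟨ cong (λ c → egf c n) (U-recurrence k j n 1≤k 1≤j j≤k (s≤s z≤n)) ⟩
  egf (U k j n + U k (j ∸ 1) n + binomialConvolution n (Ũ k (k ∸ 1)) (Ũ k j)) n
    ≡⟨ egf-+ (U k j n + U k (j ∸ 1) n) _ n ⟨
  egf (U k j n + U k (j ∸ 1) n) n ℚ.+ egf (binomialConvolution n (Ũ k (k ∸ 1)) (Ũ k j)) n
    ≡⟨ cong₂ ℚ._+_ (egf-+ (U k j n) (U k (j ∸ 1) n) n) (egf-convolution n (Ũ k (k ∸ 1)) (Ũ k j)) ⟨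
  𝒰 k j n ℚ.+ 𝒰 k (j ∸ 1) n ℚ.+ sumTo n (λ i → egf (Ũ k (k ∸ 1) i) i ℚ.* egf (Ũ k j (n ∸ i)) (n ∸ i))
    ≡⟨ cong₂ ℚ._+_ (cong (ℚ._+ 𝒰 k (j ∸ 1) n) (ℚ.+-identityˡ (𝒰 k j n)))
                   (sumTo-cong n _ _ λ i _ → cong₂ ℚ._*_ (𝒰≡egf k (k ∸ 1) i) (𝒰≡egf k j (n ∸ i))) ⟨
  ℚ.0ℚ ℚ.+ 𝒰 k j n ℚ.+ 𝒰 k (j ∸ 1) n ℚ.+ (𝒰 k (k ∸ 1) ⊛ 𝒰 k j) n ∎
  where open ≡-Reasoning
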